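{- Let $s\in S^c$, $i\in\mathbf{Ag}$, and let $\Gamma$ be a maximal $\mathbf{SLKvr}$-consistent set with $\{\phi\mid\Box_i\phi\in\Gamma_s\}\subseteq\Gamma$, and let $x\in\mathbb{N}$. Then there exist $f:\mathbf{D}\to\mathbb{N}$ and $g:\mathbf{Ag}\times\mathcal{L}\times\mathbf{D}\to\mathbb{N}\cup\{*\}$ such that $t=\langle\Gamma,f,g\rangle\in S^c$ and $sR^c_it$.
   Context: Language $\mathcal{L}$: fix countably infinite sets $\mathbf{P}$ (proposition letters), $\mathbf{Ag}$ (agents), $\mathbf{D}$ (constant symbols); formulas $\phi ::= \top\mid p\mid\neg\phi\mid(\phi\wedge\phi)\mid\Box_i\phi\mid\nabla_i(\phi,d)$, with $\Diamond_i\phi:=\neg\Box_i\neg\phi$ and usual Boolean abbreviations. Proof system $\mathbf{SLKvr}$: axioms all tautologies; $\Box_i(\phi\to\psi)\to(\Box_i\phi\to\Box_i\psi)$; $\Box_i(\phi\to\psi)\to(\nabla_i(\psi,d)\to\nabla_i(\phi,d))$; $\nabla_i(\bot,d)$; $\Diamond_i(\phi\wedge\psi)\wedge\nabla_i(\phi,d)\wedge\nabla_i(\psi,d)\to\nabla_i(\phi\vee\psi,d)$; rules modus ponens, necessitation for $\Box_i$, and replacement of provable equivalents. Canonical structure: $S^c$ is the set of all triples $\langle\Gamma,f,g\rangle$ where $\Gamma$ is a maximal $\mathbf{SLKvr}$-consistent set, $f:\mathbf{D}\to\mathbb{N}$, $g:\mathbf{Ag}\times\mathcal{L}\times\mathbf{D}\to\mathbb{N}\cup\{*\}$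 (with $*\notin\mathbb{N}$), such that for all $i,\phi,\psi,d$: (1) $g(i,\phi,d)\neq *$ iff $\nabla_i(\phi,d)\wedge\Diamond_i\phi\in\Gamma$; (2) if $g(i,\phi,d)\neq*$ and $g(i,\psi,d)\neq*$ then: $g(i,\phi,d)=g(i,\psi,d)$ iff $\nabla_i(\phi\vee\psi,d)\in\Gamma$. For $s\in S^c$ write $s=\langle\Gamma_s,f_s,g_s\rangle$. For $s,t\in S^c$, $sR^c_it$ iff (3) $\{\phi\mid\Box_i\phi\in\Gamma_s\}\subseteq\Gamma_t$ and (4) whenever $\nabla_i(\phi,d)\in\Gamma_s$ and $\phi\in\Gamma_t$, $f_t(d)=g_s(i,\phi,d)$. -}

module Defs where

open import Data.Nat using (ℕ)
open import Data.Bool using (Bool; true; false; not; _∧_)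
open import Data.List using (List; []; _∷_)
open import Data.List.Relation.Unary.All using (All)
open import Data.Maybe using (Maybe; just; nothing)
open import Data.Product using (_×_; Σ)
open import Data.Sum using (_⊎_)
open import Relation.Nullary using (¬_)
open import Relation.Binary.PropositionalEquality using (_≡_; _≢_)
open import Function.Bundles using (_⇔_)

PropLetter : Set
PropLetter = ℕ

Agent : Set
Agent = ℕ

Const : Set
Const = ℕ

data Fm : Set where
  ⊤'   : Fm
  var  : PropLetter → Fm
  ¬'_  : Fm → Fm
  _∧'_ : Fm → Fm → Fm
  □    : Agent → Fm → Fm
  ∇    : Agent → Fm → Const → Fm

infixr 6 _∧'_
infixr 5 _∨'_
infixr 4 _⇒'_ _⇔'_

⊥' : Fm
⊥' = ¬' ⊤'

_∨'_ : Fm → Fm → Fm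
φ ∨' ψ = ¬' ((¬' φ) ∧' (¬' ψ))

_⇒'_ : Fm → Fm → Fm
φ ⇒' ψ = ¬' (φ ∧' (¬' ψ))

_⇔'_ : Fm → Fm → Fm
φ ⇔' ψ = (φ ⇒' ψ) ∧' (ψ ⇒' φ)

◇ : Agent → Fm → Fm
◇ i φ = ¬' (□ i (¬' φ))

eval : (PropLetter → Bool) → (Agent → Fm → Bool) → (Agent → Fm → Const → Bool) → Fm → Bool
eval a b c ⊤' = true
eval a b c (var p) = a p
eval a b c (¬' φ) = not (eval a b c φ)
eval a b c (φ ∧' ψ) = eval a b c φ ∧ eval a b c ψ
eval a b c (□ i φ) = b i φ
eval a b c (∇ i φ d) = c i φ d

-- φ is a (substitution instance of a propositional) tautology
Tautology : Fm → Set
Tautology φ = ∀ a b c → eval a b c φ ≡ true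

-- Repl φ ψ χ χ' : χ' arises from χ by replacing some occurrences of φ by ψ
data Repl (φ ψ : Fm) : Fm → Fm → Set where
  here  : Repl φ ψ φ ψ
  refl' : ∀ {χ} → Repl φ ψ χ χ
  neg   : ∀ {χ χ'} → Repl φ ψ χ χ' → Repl φ ψ (¬' χ) (¬' χ')
  conj  : ∀ {χ₁ χ₁' χ₂ χ₂'} → Repl φ ψ χ₁ χ₁' → Repl φ ψ χ₂ χ₂' →
          Repl φ ψ (χ₁ ∧' χ₂) (χ₁' ∧' χ₂')
  box   : ∀ {i χ χ'} → Repl φ ψ χ χ' → Repl φ ψ (□ i χ) (□ i χ')
  nab   : ∀ {i χ χ' d} → Repl φ ψ χ χ' → Repl φ ψ (∇ i χ d) (∇ i χ' d)

infix 2 ⊢_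
data ⊢_ : Fm → Set where
  taut  : ∀ {φ} → Tautology φ → ⊢ φ
  K     : ∀ {i φ ψ} → ⊢ □ i (φ ⇒' ψ) ⇒' (□ i φ ⇒' □ i ψ)
  Mono∇ : ∀ {i φ ψ d} → ⊢ □ i (φ ⇒' ψ) ⇒' (∇ i ψ d ⇒' ∇ i φ d)
  Bot∇  : ∀ {i d} → ⊢ ∇ i ⊥' d
  Join∇ : ∀ {i φ ψ d} →
          ⊢ (◇ i (φ ∧' ψ) ∧' ∇ i φ d ∧' ∇ i ψ d) ⇒' ∇ i (φ ∨' ψ) d
  mp    : ∀ {φ ψ} → ⊢ φ ⇒' ψ → ⊢ φ → ⊢ ψ
  nec   : ∀ {i φ} → ⊢ φ → ⊢ □ i φ
  re    : ∀ {φ ψ χ χ'} → ⊢ φ ⇔' ψ → Repl φ ψ χ χ' → ⊢ χ ⇔' χ'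

FmSet : Set₁
FmSet = Fm → Set

conjL : List Fm → Fm
conjL [] = ⊤'
conjL (φ ∷ l) = φ ∧' conjL l

Consistent : FmSet → Set
Consistent Γ = ¬ Σ (List Fm) (λ l → All Γ l × (⊢ ¬' conjL l))

MaxCons : FmSet → Set
MaxCons Γ = Consistent Γ × (∀ φ → ¬ Γ φ → ¬ Consistent (λ ψ → Γ ψ ⊎ ψ ≡ φ))

-- N ∪ {*} rendered as Maybe ℕ, with * = nothing
-- Conditions (1) and (2) on a triple ⟨Γ,f,g⟩
IsCanonical : FmSet → (Const → ℕ) → (Agent → Fm → Const → Maybe ℕ) → Set
IsCanonical Γ f g =
  (∀ i φ d → (g i φ d ≢ nothing) ⇔ Γ (∇ i φ d ∧' ◇ i φ)) ×
  (∀ i φ ψ d m n → g i φ d ≡ just m → g i ψ d ≡ just n →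
     (m ≡ n) ⇔ Γ (∇ i (φ ∨' ψ) d))

record State : Set₁ where
  constructor ⟨_,_,_⟩[_,_]
  field
    Γ   : FmSet
    f   : Const → ℕ
    g   : Agent → Fm → Const → Maybe ℕ
    mcs : MaxCons Γ
    can : IsCanonical Γ f g

open State public

R : Agent → State → State → Set
R i s t =
  (∀ φ → Γ s (□ i φ) → Γ t φ) ×
  (∀ φ d → Γ s (∇ i φ d) → Γ t φ → just (f t d) ≡ g s i φ d)

-- The values g(j,φ,d)
-- must realise the partial equivalence φ ≈ ψ :⇔ ∇_j(φ ∨ ψ, d) ∈ Γ on the formulas with
-- ∇_j(φ,d) ∧ ◇_j φ ∈ Γ (reflexive there by ∇-monotonicity, transitive by the Join
-- axiom); formulas are countable, so g can return the least code of a formula in the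
-- class of φ.  The value f(d) must equal g_s(i,φ,d) whenever ∇_i(φ,d) ∈ Γ_s and φ ∈ Γ;
-- all these φ give the same value because φ ∧ ψ ∈ Γ forces ◇_i(φ ∧ ψ) ∈ Γ_s, so Join
-- puts ∇_i(φ ∨ ψ, d) into Γ_s and condition (2) for s applies.  When there is no such φ
-- the value of f(d) is irrelevant and we take x.
module Submission where

open import Defs
open import Data.Bool using (Bool; true; false; not; _∧_; if_then_else_; T)
open import Data.Bool.Properties using (T-∧; T-≡; ∧-assoc; ∧-inverseʳ)
open import Data.Nat using (ℕ; zero; suc; _<_; _≡ᵇ_)
open import Data.Nat.Properties using (≡ᵇ⇒≡; ≤-antisym; ≮⇒≥; anyUpTo?)
open import Data.Nat.Induction using (<-wellFounded)
open import Data.Nat.Binary using (ℕᵇ; 2[1+_]; 1+[2_]) renaming (zero to 0ᵇ; toℕ to ℕᵇ→ℕ)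
open import Data.Nat.Binary.Properties using (2[1+_]-injective; 1+[2_]-injective; toℕ-injective)
open import Data.List using (List; []; _∷_; _++_; length)
open import Data.List.Properties using (∷-injectiveˡ)
open import Data.List.Relation.Unary.All using (All; []; _∷_)
open import Data.List.Relation.Unary.All.Properties using (++⁺)
open import Data.Maybe using (Maybe; just; nothing; fromMaybe)
open import Data.Maybe.Properties using (just-injective)
open import Data.Product using (Σ; _×_; _,_; proj₁; proj₂)
open import Data.Sum using (_⊎_; inj₁; inj₂)
open import Data.Empty using (⊥-elim)
open import Function.Bundles using (_⇔_; mk⇔; Equivalence)
open import Induction.WellFounded using (Acc; acc)
open import Level using (0ℓ)
open import Relation.Nullary using (¬_; Dec; yes; no)
open import Relation.Unary using (_⊆_; _≐_)
open import Relation.Binary.PropositionalEquality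
open import Axiom.ExcludedMiddle using (ExcludedMiddle)

private
  variable
    φ ψ χ : Fm
    i : Agent
    d : Const
    Θ : FmSet

sub : (PropLetter → Fm) → Fm → Fm
sub σ ⊤'        = ⊤'
sub σ (var p)   = σ p
sub σ (¬' X)    = ¬' sub σ X
sub σ (X ∧' Y)  = sub σ X ∧' sub σ Y
sub σ (□ j X)   = □ j X
sub σ (∇ j X e) = ∇ j X e

eval-sub : ∀ a b c σ X → eval a b c (sub σ X) ≡ eval (λ p → eval a b c (σ p)) b c X
eval-sub a b c σ ⊤'        = refl
eval-sub a b c σ (var p)   = refl
eval-sub a b c σ (¬' X)    = cong not (eval-sub a b c σ X)
eval-sub a b c σ (X ∧' Y)  = cong₂ _∧_ (eval-sub a b c σ X) (eval-sub a b c σ Y)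
eval-sub a b c σ (□ j X)   = refl
eval-sub a b c σ (∇ j X e) = refl

sub-tautology : ∀ σ X → Tautology X → Tautology (sub σ X)
sub-tautology σ X taut-X a b c = trans (eval-sub a b c σ X) (taut-X _ b c)

eval-cong : ∀ {a a′} b c X → (∀ p → a p ≡ a′ p) → eval a b c X ≡ eval a′ b c X
eval-cong b c ⊤'        a≗a′ = refl
eval-cong b c (var p)   a≗a′ = a≗a′ p
eval-cong b c (¬' X)    a≗a′ = cong not (eval-cong b c X a≗a′)
eval-cong b c (X ∧' Y)  a≗a′ = cong₂ _∧_ (eval-cong b c X a≗a′) (eval-cong b c Y a≗a′)
eval-cong b c (□ j X)   a≗a′ = refl
eval-cong b c (∇ j X e) a≗a′ = refl

_[_≔_] : (PropLetter → Bool) → PropLetter → Bool → PropLetter → Bool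
(a [ n ≔ x ]) p = if p ≡ᵇ n then x else a p

update-self : ∀ {a n x} → a n ≡ x → ∀ p → a p ≡ (a [ n ≔ x ]) p
update-self {a} {n} an≡x p with p ≡ᵇ n in p≡ᵇn
... | true  = trans (cong a (≡ᵇ⇒≡ p n (subst T (sym p≡ᵇn) _))) an≡x
... | false = refl

truthTable : ℕ → Fm → (PropLetter → Bool) → (Agent → Fm → Bool) → (Agent → Fm → Const → Bool) →
             Bool
truthTable zero    X a b c = eval a b c X
truthTable (suc n) X a b c =
  truthTable n X (a [ n ≔ true ]) b c ∧ truthTable n X (a [ n ≔ false ]) b c

truthTable-sound : ∀ n X a b c → T (truthTable n X a b c) → eval a b c X ≡ true
truthTable-sound zero    X a b c table = Equivalence.to T-≡ table
truthTable-sound (suc n) X a b c table with Equivalence.to T-∧ table | a n in an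
... | table₁ , _ | true  =
  trans (eval-cong b c X (update-self an)) (truthTable-sound n X _ b c table₁)
... | _ , table₂ | false =
  trans (eval-cong b c X (update-self an)) (truthTable-sound n X _ b c table₂)

_!_ : List Fm → PropLetter → Fm
[]       ! p     = ⊤'
(φ ∷ φs) ! zero  = φ
(φ ∷ φs) ! suc p = φs ! p

p₀ p₁ p₂ p₃ : Fm
p₀ = var 0
p₁ = var 1
p₂ = var 2
p₃ = var 3

-- The implicit argument is solved by computation exactly when the truth table of the
-- schema X in the letters p₀, …, p_{length φs - 1} is constantly true.
tautology : ∀ X φs → {∀ a b c → T (truthTable (length φs) X a b c)} → Tautology (sub (φs !_) X)
tautology X φs {table} =
  sub-tautology (φs !_) X λ a b c → truthTable-sound (length φs) X a b c (table a b c)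

⇒-of-eval-≡ : ∀ φ ψ → (∀ a b c → eval a b c φ ≡ eval a b c ψ) → Tautology (φ ⇒' ψ)
⇒-of-eval-≡ φ ψ φ≡ψ a b c =
  trans (cong (λ y → not (eval a b c φ ∧ not y)) (sym (φ≡ψ a b c)))
        (cong not (∧-inverseʳ (eval a b c φ)))

eval-conjL-++ : ∀ a b c l l′ →
                eval a b c (conjL (l ++ l′)) ≡ eval a b c (conjL l) ∧ eval a b c (conjL l′)
eval-conjL-++ a b c []      l′ = refl
eval-conjL-++ a b c (φ ∷ l) l′ =
  trans (cong (eval a b c φ ∧_) (eval-conjL-++ a b c l l′)) (sym (∧-assoc (eval a b c φ) _ _))

conjL-++ : ∀ l l′ → ⊢ conjL (l ++ l′) ⇒' conjL l ∧' conjL l′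
conjL-++ l l′ =
  taut (⇒-of-eval-≡ (conjL (l ++ l′)) (conjL l ∧' conjL l′) λ a b c → eval-conjL-++ a b c l l′)

⊢-taut-mp : Tautology (φ ⇒' ψ) → ⊢ φ → ⊢ ψ
⊢-taut-mp φ⇒ψ ⊢φ = mp (taut φ⇒ψ) ⊢φ

⇒-trans : ⊢ φ ⇒' ψ → ⊢ ψ ⇒' χ → ⊢ φ ⇒' χ
⇒-trans {φ} {ψ} {χ} φ⇒ψ =
  mp (⊢-taut-mp (tautology ((p₀ ⇒' p₁) ⇒' (p₁ ⇒' p₂) ⇒' p₀ ⇒' p₂) (φ ∷ ψ ∷ χ ∷ [])) φ⇒ψ)

contraposition : ⊢ φ ⇒' ψ → ⊢ ¬' ψ ⇒' ¬' φ
contraposition {φ} {ψ} = ⊢-taut-mp (tautology ((p₀ ⇒' p₁) ⇒' ¬' p₁ ⇒' ¬' p₀) (φ ∷ ψ ∷ []))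

□-mono : ⊢ φ ⇒' ψ → ⊢ □ i φ ⇒' □ i ψ
□-mono φ⇒ψ = mp K (nec φ⇒ψ)

◇-mono : ⊢ φ ⇒' ψ → ⊢ ◇ i φ ⇒' ◇ i ψ
◇-mono φ⇒ψ = contraposition (□-mono (contraposition φ⇒ψ))

∇-antitone : ⊢ φ ⇒' ψ → ⊢ ∇ i ψ d ⇒' ∇ i φ d
∇-antitone φ⇒ψ = mp Mono∇ (nec φ⇒ψ)

infix 2 _⊩_
_⊩_ : FmSet → Fm → Set
Θ ⊩ φ = Σ (List Fm) λ l → All Θ l × (⊢ conjL l ⇒' φ)

∈⇒⊩ : Θ φ → Θ ⊩ φ
∈⇒⊩ {φ = φ} φ∈ = φ ∷ [] , φ∈ ∷ [] , taut (tautology (p₀ ∧' ⊤' ⇒' p₀) (φ ∷ []))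

⊩-mp : Θ ⊩ φ → ⊢ φ ⇒' ψ → Θ ⊩ ψ
⊩-mp (l , l⊆Θ , l⇒φ) φ⇒ψ = l , l⊆Θ , ⇒-trans l⇒φ φ⇒ψ

⊩-∧ : Θ ⊩ φ → Θ ⊩ ψ → Θ ⊩ φ ∧' ψ
⊩-∧ {φ = φ} {ψ = ψ} (l , l⊆Θ , l⇒φ) (l′ , l′⊆Θ , l′⇒ψ) =
  l ++ l′ , ++⁺ l⊆Θ l′⊆Θ , ⇒-trans (conjL-++ l l′) conjunction
  where
  conjunction : ⊢ conjL l ∧' conjL l′ ⇒' φ ∧' ψ
  conjunction = mp (⊢-taut-mp (tautology ((p₀ ⇒' p₁) ⇒' (p₂ ⇒' p₃) ⇒' p₀ ∧' p₂ ⇒' p₁ ∧' p₃)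
                                         (conjL l ∷ φ ∷ conjL l′ ∷ ψ ∷ [])) l⇒φ) l′⇒ψ

⊩-inconsistent : Θ ⊩ φ → Θ ⊩ ¬' φ → ¬ Consistent Θ
⊩-inconsistent {φ = φ} ⊩φ ⊩¬φ consistent with ⊩-∧ ⊩φ ⊩¬φ
... | l , l⊆Θ , l⇒⊥ =
  consistent (l , l⊆Θ ,
              ⊢-taut-mp (tautology ((p₀ ⇒' p₁ ∧' ¬' p₁) ⇒' ¬' p₀) (conjL l ∷ φ ∷ [])) l⇒⊥)

⊩-insert : ∀ {l} → All (λ χ → Θ χ ⊎ χ ≡ ψ) l → Θ ⊩ (ψ ⇒' conjL l)
⊩-insert {ψ = ψ} [] = [] , [] , taut (tautology (p₀ ⇒' p₁ ⇒' p₀) (⊤' ∷ ψ ∷ []))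
⊩-insert {ψ = ψ} {χ ∷ l} (inj₁ χ∈ ∷ l⊆) =
  ⊩-mp (⊩-∧ (∈⇒⊩ χ∈) (⊩-insert l⊆))
       (taut (tautology (p₀ ∧' (p₁ ⇒' p₂) ⇒' p₁ ⇒' p₀ ∧' p₂) (χ ∷ ψ ∷ conjL l ∷ [])))
⊩-insert {ψ = ψ} {_ ∷ l} (inj₂ refl ∷ l⊆) =
  ⊩-mp (⊩-insert l⊆) (taut (tautology ((p₀ ⇒' p₁) ⇒' p₀ ⇒' p₀ ∧' p₁) (ψ ∷ conjL l ∷ [])))

insert-inconsistent⇒⊩¬ : ExcludedMiddle 0ℓ → ¬ Consistent (λ χ → Θ χ ⊎ χ ≡ φ) → Θ ⊩ ¬' φ
insert-inconsistent⇒⊩¬ {Θ} {φ} em inconsistent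
  with em {Σ (List Fm) λ l → All (λ χ → Θ χ ⊎ χ ≡ φ) l × (⊢ ¬' conjL l)}
... | yes (l , l⊆ , ⊢¬l) =
  ⊩-mp (⊩-insert l⊆) (⊢-taut-mp (tautology (¬' p₁ ⇒' (p₀ ⇒' p₁) ⇒' ¬' p₀) (φ ∷ conjL l ∷ [])) ⊢¬l)
... | no consistent = ⊥-elim (inconsistent consistent)

module MaxConsSet (em : ExcludedMiddle 0ℓ) {Θ : FmSet} (mc : MaxCons Θ) where

  ⊩⇒∈ : Θ ⊩ φ → Θ φ
  ⊩⇒∈ {φ} ⊩φ with em {Θ φ}
  ... | yes φ∈ = φ∈
  ... | no  φ∉ = ⊥-elim (⊩-inconsistent ⊩φ (insert-inconsistent⇒⊩¬ em (proj₂ mc φ φ∉)) (proj₁ mc))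

  ∉⇒¬∈ : ¬ Θ φ → Θ (¬' φ)
  ∉⇒¬∈ {φ} φ∉ = ⊩⇒∈ (insert-inconsistent⇒⊩¬ em (proj₂ mc φ φ∉))

  ¬∈⇒∉ : Θ (¬' φ) → ¬ Θ φ
  ¬∈⇒∉ ¬φ∈ φ∈ = ⊩-inconsistent (∈⇒⊩ φ∈) (∈⇒⊩ ¬φ∈) (proj₁ mc)

  ∈-mp : Θ φ → ⊢ φ ⇒' ψ → Θ ψ
  ∈-mp φ∈ φ⇒ψ = ⊩⇒∈ (⊩-mp (∈⇒⊩ φ∈) φ⇒ψ)

  ∈-∧ : Θ φ → Θ ψ → Θ (φ ∧' ψ)
  ∈-∧ φ∈ ψ∈ = ⊩⇒∈ (⊩-∧ (∈⇒⊩ φ∈) (∈⇒⊩ ψ∈))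

  ∈-∧ˡ : Θ (φ ∧' ψ) → Θ φ
  ∈-∧ˡ {φ} {ψ} φ∧ψ∈ = ∈-mp φ∧ψ∈ (taut (tautology (p₀ ∧' p₁ ⇒' p₀) (φ ∷ ψ ∷ [])))

  ∈-∧ʳ : Θ (φ ∧' ψ) → Θ ψ
  ∈-∧ʳ {φ} {ψ} φ∧ψ∈ = ∈-mp φ∧ψ∈ (taut (tautology (p₀ ∧' p₁ ⇒' p₁) (φ ∷ ψ ∷ [])))

  ∈-join : Θ (◇ i (φ ∧' ψ)) → Θ (∇ i φ d) → Θ (∇ i ψ d) → Θ (∇ i (φ ∨' ψ) d)
  ∈-join ◇∈ ∇φ∈ ∇ψ∈ = ∈-mp (∈-∧ ◇∈ (∈-∧ ∇φ∈ ∇ψ∈)) Join∇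

◇-of-successor : ExcludedMiddle 0ℓ → ∀ {Θ Δ} → MaxCons Θ → MaxCons Δ →
                 (∀ φ → Θ (□ i φ) → Δ φ) → Δ φ → Θ (◇ i φ)
◇-of-successor {i} {φ} em {Θ} mcΘ mcΔ □⊆ φ∈Δ with em {Θ (◇ i φ)}
... | yes ◇φ∈ = ◇φ∈
... | no  ◇φ∉ = ⊥-elim (Δ.¬∈⇒∉ (□⊆ (¬' φ) □¬φ∈) φ∈Δ)
  where
  module Θ = MaxConsSet em mcΘ
  module Δ = MaxConsSet em mcΔ
  □¬φ∈ : Θ (□ i (¬' φ))
  □¬φ∈ = Θ.∈-mp (Θ.∉⇒¬∈ ◇φ∉) (taut (tautology (¬' ¬' p₀ ⇒' p₀) (□ i (¬' φ) ∷ [])))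

tokens : Fm → List ℕ → List ℕ
tokens ⊤'        ts = 0 ∷ ts
tokens (var p)   ts = 1 ∷ p ∷ ts
tokens (¬' φ)    ts = tokens φ (2 ∷ ts)
tokens (φ ∧' ψ)  ts = tokens φ (tokens ψ (3 ∷ ts))
tokens (□ j φ)   ts = tokens φ (4 ∷ j ∷ ts)
tokens (∇ j φ e) ts = tokens φ (5 ∷ j ∷ e ∷ ts)

-- A stack machine reading the postfix notation produced by tokens.
parse : List ℕ → List Fm → Maybe (List Fm)
parse []                    st           = just st
parse (0 ∷ ts)              st           = parse ts (⊤' ∷ st)
parse (1 ∷ p ∷ ts)          st           = parse ts (var p ∷ st)
parse (2 ∷ ts)              (φ ∷ st)     = parse ts (¬' φ ∷ st)
parse (3 ∷ ts)              (ψ ∷ φ ∷ st) = parse ts (φ ∧' ψ ∷ st)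
parse (4 ∷ j ∷ ts)          (φ ∷ st)     = parse ts (□ j φ ∷ st)
parse (5 ∷ j ∷ e ∷ ts)      (φ ∷ st)     = parse ts (∇ j φ e ∷ st)
parse _                     _            = nothing

parse-tokens : ∀ φ ts st → parse (tokens φ ts) st ≡ parse ts (φ ∷ st)
parse-tokens ⊤'        ts st = refl
parse-tokens (var p)   ts st = refl
parse-tokens (¬' φ)    ts st = parse-tokens φ (2 ∷ ts) st
parse-tokens (φ ∧' ψ)  ts st = trans (parse-tokens φ _ st) (parse-tokens ψ (3 ∷ ts) (φ ∷ st))
parse-tokens (□ j φ)   ts st = parse-tokens φ (4 ∷ j ∷ ts) st
parse-tokens (∇ j φ e) ts st = parse-tokens φ (5 ∷ j ∷ e ∷ ts) st

tokens-injective : tokens φ [] ≡ tokens ψ [] → φ ≡ ψ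
tokens-injective {φ} {ψ} eq = ∷-injectiveˡ (just-injective (begin
  just (φ ∷ [])           ≡⟨ parse-tokens φ [] [] ⟨
  parse (tokens φ []) []  ≡⟨ cong (λ ts → parse ts []) eq ⟩
  parse (tokens ψ []) []  ≡⟨ parse-tokens ψ [] [] ⟩
  just (ψ ∷ [])           ∎))
  where open ≡-Reasoning

-- Unary notation in the two successor-like constructors of ℕᵇ, hence a prefix code.
unary : ℕ → ℕᵇ → ℕᵇ
unary zero    r = 1+[2 r ]
unary (suc n) r = 2[1+ unary n r ]

unary-injective : ∀ m n {r r′} → unary m r ≡ unary n r′ → m ≡ n × r ≡ r′
unary-injective zero    zero    eq = refl , 1+[2_]-injective eq
unary-injective (suc m) (suc n) eq with unary-injective m n (2[1+_]-injective eq)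
... | refl , r≡r′ = refl , r≡r′

listCode : List ℕ → ℕᵇ
listCode []       = 0ᵇ
listCode (n ∷ ns) = unary n (listCode ns)

listCode-injective : ∀ ms ns → listCode ms ≡ listCode ns → ms ≡ ns
listCode-injective []       []       eq = refl
listCode-injective []       (zero  ∷ ns) ()
listCode-injective []       (suc _ ∷ ns) ()
listCode-injective (zero  ∷ ms) [] ()
listCode-injective (suc _ ∷ ms) [] ()
listCode-injective (m ∷ ms) (n ∷ ns) eq with unary-injective m n eq
... | refl , rest = cong (m ∷_) (listCode-injective ms ns rest)

code : Fm → ℕ
code φ = ℕᵇ→ℕ (listCode (tokens φ []))

code-injective : code φ ≡ code ψ → φ ≡ ψ
code-injective {φ} {ψ} eq = tokens-injective (listCode-injective _ _ (toℕ-injective eq))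

IsLeast : (ℕ → Set) → ℕ → Set
IsLeast P n = P n × (∀ {k} → k < n → ¬ P k)

least : ExcludedMiddle 0ℓ → {P : ℕ → Set} {n : ℕ} → P n → Σ ℕ (IsLeast P)
least em {P} = descend (<-wellFounded _)
  where
  descend : ∀ {n} → Acc _<_ n → P n → Σ ℕ (IsLeast P)
  descend {n} (acc smaller) Pn with anyUpTo? (λ _ → em) n
  ... | yes (k , k<n , Pk) = descend (smaller k<n) Pk
  ... | no  none           = n , Pn , λ k<n Pk → none (_ , k<n , Pk)

IsLeast-unique : ∀ {P Q : ℕ → Set} {m n} → P ≐ Q → IsLeast P m → IsLeast Q n → m ≡ n
IsLeast-unique (P⊆Q , Q⊆P) (Pm , below-m) (Qn , below-n) =
  ≤-antisym (≮⇒≥ λ n<m → below-m n<m (Q⊆P Qn)) (≮⇒≥ λ m<n → below-n m<n (P⊆Q Pm))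

module ClassIndex (em : ExcludedMiddle 0ℓ) {Θ : FmSet} (mc : MaxCons Θ) (j : Agent) (d : Const)
  where
  open MaxConsSet em mc

  Defined : Fm → Set
  Defined φ = Θ (∇ j φ d ∧' ◇ j φ)

  _≈_ : Fm → Fm → Set
  φ ≈ ψ = Θ (∇ j (φ ∨' ψ) d)

  ≈-refl : Defined φ → φ ≈ φ
  ≈-refl {φ} δ = ∈-mp (∈-∧ˡ δ) (∇-antitone (taut (tautology (p₀ ∨' p₀ ⇒' p₀) (φ ∷ []))))

  ≈-sym : φ ≈ ψ → ψ ≈ φ
  ≈-sym {φ} {ψ} φ≈ψ = ∈-mp φ≈ψ (∇-antitone (taut (tautology (p₁ ∨' p₀ ⇒' p₀ ∨' p₁) (φ ∷ ψ ∷ []))))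

  ≈-trans : Defined ψ → φ ≈ ψ → ψ ≈ χ → φ ≈ χ
  ≈-trans {ψ} {φ} {χ} δ φ≈ψ ψ≈χ = ∈-mp (∈-join ◇-overlap φ≈ψ ψ≈χ)
    (∇-antitone (taut (tautology (p₀ ∨' p₂ ⇒' (p₀ ∨' p₁) ∨' (p₁ ∨' p₂)) (φ ∷ ψ ∷ χ ∷ []))))
    where
    ◇-overlap : Θ (◇ j ((φ ∨' ψ) ∧' (ψ ∨' χ)))
    ◇-overlap = ∈-mp (∈-∧ʳ δ)
      (◇-mono (taut (tautology (p₁ ⇒' (p₀ ∨' p₁) ∧' (p₁ ∨' p₂)) (φ ∷ ψ ∷ χ ∷ []))))

  CodeInClass : Fm → ℕ → Set
  CodeInClass φ n = Σ Fm λ χ → code χ ≡ n × Defined χ × χ ≈ φ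

  CodeInClass-resp : Defined φ → φ ≈ ψ → CodeInClass φ ⊆ CodeInClass ψ
  CodeInClass-resp δ φ≈ψ (χ , code-χ , δχ , χ≈φ) = χ , code-χ , δχ , ≈-trans δ χ≈φ φ≈ψ

  leastCodeInClass : Defined φ → Σ ℕ (IsLeast (CodeInClass φ))
  leastCodeInClass {φ} δ = least em {CodeInClass φ} {code φ} (φ , refl , δ , ≈-refl δ)

  classIndex : ∀ φ → Dec (Defined φ) → Maybe ℕ
  classIndex φ (yes δ) = just (proj₁ (leastCodeInClass δ))
  classIndex φ (no  _) = nothing

  classIndex-defined : ∀ φ D → (classIndex φ D ≢ nothing) ⇔ Defined φ
  classIndex-defined φ (yes δ) = mk⇔ (λ _ → δ) (λ _ ())
  classIndex-defined φ (no ¬δ) = mk⇔ (λ ≢nothing → ⊥-elim (≢nothing refl)) (λ δ → ⊥-elim (¬δ δ))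

  classIndex-least : ∀ φ D {n} → classIndex φ D ≡ just n → Defined φ × IsLeast (CodeInClass φ) n
  classIndex-least φ (yes δ) refl = δ , proj₂ (leastCodeInClass δ)

  classIndex-≡ : ∀ φ ψ D D′ {m n} → classIndex φ D ≡ just m → classIndex ψ D′ ≡ just n →
                 (m ≡ n) ⇔ φ ≈ ψ
  classIndex-≡ φ ψ D D′ φ↦m ψ↦n with classIndex-least φ D φ↦m | classIndex-least ψ D′ ψ↦n
  ... | δφ , least-m@((χ , refl , δχ , χ≈φ) , _) | δψ , least-n@((χ′ , refl , _ , χ′≈ψ) , _) =
    mk⇔ same-code⇒≈ λ φ≈ψ →
      IsLeast-unique (CodeInClass-resp δφ φ≈ψ , CodeInClass-resp δψ (≈-sym φ≈ψ)) least-m least-n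
    where
    same-code⇒≈ : code χ ≡ code χ′ → φ ≈ ψ
    same-code⇒≈ same with code-injective {χ} {χ′} same
    ... | refl = ≈-trans δχ (≈-sym χ≈φ) χ′≈ψ

canonicalG : ExcludedMiddle 0ℓ → ∀ {Θ} → MaxCons Θ → Agent → Fm → Const → Maybe ℕ
canonicalG em mc j φ d = ClassIndex.classIndex em mc j d φ em

canonicalG-isCanonical : (em : ExcludedMiddle 0ℓ) (mc : MaxCons Θ) (f : Const → ℕ) →
                         IsCanonical Θ f (canonicalG em mc)
canonicalG-isCanonical em mc f =
  (λ j φ d → ClassIndex.classIndex-defined em mc j d φ em) ,
  (λ j φ ψ d m n → ClassIndex.classIndex-≡ em mc j d φ ψ em em)

just-fromMaybe : ∀ {A : Set} (x : A) {m} → m ≢ nothing → just (fromMaybe x m) ≡ m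
just-fromMaybe x {just _}  _ = refl
just-fromMaybe x {nothing} m≢nothing = ⊥-elim (m≢nothing refl)

module SuccessorConstants (em : ExcludedMiddle 0ℓ) (s : State) (i : Agent) {Δ : FmSet}
                          (mcΔ : MaxCons Δ) (□⊆ : ∀ φ → Γ s (□ i φ) → Δ φ) where
  open MaxConsSet em (mcs s)

  g-defined : Γ s (∇ i φ d) → Δ φ → g s i φ d ≢ nothing
  g-defined {φ} {d} ∇φ∈ φ∈Δ =
    Equivalence.from (proj₁ (can s) i φ d) (∈-∧ ∇φ∈ (◇-of-successor em (mcs s) mcΔ □⊆ φ∈Δ))

  g-agree : Γ s (∇ i φ d) → Δ φ → Γ s (∇ i ψ d) → Δ ψ → g s i φ d ≡ g s i ψ d
  g-agree {φ} {d} {ψ} ∇φ∈ φ∈Δ ∇ψ∈ ψ∈Δ with g s i φ d in φ↦ | g s i ψ d in ψ↦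
  ... | nothing | _       = ⊥-elim (g-defined ∇φ∈ φ∈Δ φ↦)
  ... | just _  | nothing = ⊥-elim (g-defined ∇ψ∈ ψ∈Δ ψ↦)
  ... | just m  | just n  = cong just (Equivalence.from (proj₂ (can s) i φ ψ d m n φ↦ ψ↦) ∇φ∨ψ∈)
    where
    ∇φ∨ψ∈ : Γ s (∇ i (φ ∨' ψ) d)
    ∇φ∨ψ∈ = ∈-join (◇-of-successor em (mcs s) mcΔ □⊆ (MaxConsSet.∈-∧ em mcΔ φ∈Δ ψ∈Δ)) ∇φ∈ ∇ψ∈

  Constrained : Const → Set
  Constrained d = Σ Fm λ φ → Γ s (∇ i φ d) × Δ φ

  constant : ℕ → ∀ d → Dec (Constrained d) → ℕ
  constant x d (yes (φ , _)) = fromMaybe x (g s i φ d)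
  constant x d (no _)        = x

  constant-agrees : ∀ x d C → Γ s (∇ i ψ d) → Δ ψ → just (constant x d C) ≡ g s i ψ d
  constant-agrees {ψ} x d (yes (φ , ∇φ∈ , φ∈Δ)) ∇ψ∈ ψ∈Δ =
    trans (just-fromMaybe x (g-defined ∇φ∈ φ∈Δ)) (g-agree ∇φ∈ φ∈Δ ∇ψ∈ ψ∈Δ)
  constant-agrees {ψ} x d (no unconstrained) ∇ψ∈ ψ∈Δ = ⊥-elim (unconstrained (ψ , ∇ψ∈ , ψ∈Δ))

proposition1 : ExcludedMiddle 0ℓ →
    (s : State) (i : Agent) (Γ₀ : FmSet) (m : MaxCons Γ₀) →
    (∀ φ → Γ s (□ i φ) → Γ₀ φ) → (x : ℕ) →
    Σ (Const → ℕ) λ f₀ → Σ (Agent → Fm → Const → Maybe ℕ) λ g₀ →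
    Σ (IsCanonical Γ₀ f₀ g₀) λ c → R i s ⟨ Γ₀ , f₀ , g₀ ⟩[ m , c ]
proposition1 em s i Γ₀ m □⊆ x =
  f₀ , canonicalG em m , canonicalG-isCanonical em m f₀ , □⊆ , λ φ d → constant-agrees x d em
  where
  open SuccessorConstants em s i m □⊆
  f₀ : Const → ℕ
  f₀ d = constant x d em
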